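{- Let $G$ be a finite graph containing two cycles that have exactly one common vertex. Then the sages win the hat guessing game on $G$.
   Context: Hat guessing game: a sage sits at each vertex of a finite graph; hat colors are $H=\{0,1,2\}$; each sage sees only his neighbours' hats and guesses his own color by a deterministic function of the neighbours' colors, fixed in advance. The sages win if there is a strategy such that for every hat placement at least one sage guesses correctly. -}

module Defs where

open import Data.Nat using (ℕ; suc)
open import Data.Fin using (Fin; zero; suc; inject₁; fromℕ)
open import Data.Bool using (Bool; T; true; false)
open import Data.Product using (Σ; ∃; ∃-syntax; _×_; _,_)
open import Relation.Binary.PropositionalEquality using (_≡_)
open import Function.Definitions using (Injective)

H : Set
H = Fin 3

record Graph (n : ℕ) : Set where
  field
    adj       : Fin n → Fin n → Bool
    symmetric : ∀ u v → adj u v ≡ adj v u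
    loopless  : ∀ v → adj v v ≡ false

  Adj : Fin n → Fin n → Set
  Adj u v = T (adj u v)

open Graph public

Placement : ℕ → Set
Placement n = Fin n → H

View : ∀ {n} → Graph n → Fin n → Set
View G v = (u : Fin _) → Adj G v u → H

Strategy : ∀ {n} → Graph n → Set
Strategy G = (v : Fin _) → View G v → H

view : ∀ {n} (G : Graph n) → Placement n → (v : Fin n) → View G v
view G c v u _ = c u

Winning : ∀ {n} (G : Graph n) → Strategy G → Set
Winning {n} G s = (c : Placement n) → ∃[ v ] (s v (view G c v) ≡ c v)

SagesWin : ∀ {n} → Graph n → Set
SagesWin G = Σ (Strategy G) (Winning G)

-- A cycle of length k + 3 in G: distinct vertices x₀,…,x_{k+2} with
-- x_i ~ x_{i+1} and x_{k+2} ~ x₀.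
record Cycle {n : ℕ} (G : Graph n) : Set where
  field
    len₋₃    : ℕ
    vertex   : Fin (suc (suc (suc len₋₃))) → Fin n
    distinct : Injective _≡_ _≡_ vertex
    step     : (i : Fin (suc (suc len₋₃))) → Adj G (vertex (inject₁ i)) (vertex (suc i))
    close    : Adj G (vertex (fromℕ (suc (suc len₋₃)))) (vertex zero)

open Cycle public

ExactlyOneCommonVertex : ∀ {n} {G : Graph n} → Cycle G → Cycle G → Set
ExactlyOneCommonVertex {n} C D =
  ∃[ w ] ((∃[ i ] vertex C i ≡ w) × (∃[ j ] vertex D j ≡ w)
         × (∀ i j → vertex C i ≡ vertex D j → vertex C i ≡ w))

-- Let w be the common vertex. The sages on a cycle other than w, numbered 1, …, k
-- along it, play a path strategy in which a neighbour equal to w is replaced by a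
-- colour encoding one bit of w's hat (one colour if it is the left neighbour, another
-- if it is the right one). If all of them guess wrong, this bit can be read off the
-- hats of sages 1 and k, which w sees. The two cycles share no other vertex, so they
-- carry the two bits "hat ≥ 1" and "hat ≥ 2" independently, and if nobody else on
-- the cycles is right, w reconstructs its own hat from them.
module Submission where

open import Defs
open import Data.Nat using (ℕ; zero; suc; _+_; _*_; _%_; _≤_; _<_; z≤n; s≤s)
open import Data.Nat.Properties using (anyUpTo?; +-comm; +-assoc; +-identityʳ; +-suc; *-suc; n≤1+n; <⇒≤; ≤-refl; m≤n⇒m<n∨m≡n)
open import Data.Nat.DivMod using (_mod_; %-distribˡ-+; [m+kn]%n≡m%n; [m+n]%n≡m%n; m<n⇒m%n≡m; m%n<n; n%n≡0)
open import Data.Fin using (Fin; zero; suc; toℕ; fromℕ; _≟_)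
open import Data.Fin.Patterns using (0F; 1F; 2F)
open import Data.Fin.Properties using (any?; toℕ-injective; toℕ-fromℕ<; toℕ-fromℕ; toℕ-inject₁; toℕ<n; fromℕ<-cong)
open import Data.Fin.Relation.Unary.Top using (‵fromℕ; ‵inject₁) renaming (view to topView)
open import Data.Bool using (Bool; true; false; T)
open import Data.Empty using (⊥-elim)
open import Data.Product using (∃; _×_; _,_)
open import Data.Sum using (inj₁; inj₂)
open import Function using (_∘_; case_of_)
open import Relation.Nullary using (¬_; Dec; yes; no)
open import Relation.Binary.PropositionalEquality

pathGuess : H → H → H
pathGuess 2F _ = 0F
pathGuess _ 0F = 1F
pathGuess _ _ = 2F

leftBoundary : Bool → H
leftBoundary false = 0F
leftBoundary true = 2F

rightBoundary : Bool → H
rightBoundary false = 1F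
rightBoundary true = 0F

readBit : H → H → Bool
readBit 0F _ = false
readBit 1F 1F = false
readBit 1F _ = true
readBit 2F _ = true

WrongAt : (ℕ → H) → ℕ → Set
WrongAt z j = z (suc j) ≢ pathGuess (z j) (z (2 + j))

Guarded : H → H → Set
Guarded a b = a ≡ 2F → b ≡ 0F

guarded-step : ∀ {a b c} → Guarded a b → b ≢ pathGuess a c → Guarded b c
guarded-step {b = 0F} _ _ ()
guarded-step {b = 1F} _ _ ()
guarded-step {2F} {2F} g _ _ with g refl
... | ()
guarded-step {0F} {2F} {0F} _ _ _ = refl
guarded-step {0F} {2F} {suc _} _ b≢ _ = ⊥-elim (b≢ refl)
guarded-step {1F} {2F} {0F} _ _ _ = refl
guarded-step {1F} {2F} {suc _} _ b≢ _ = ⊥-elim (b≢ refl)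

guarded-along : ∀ {z k} → (∀ j → j < k → WrongAt z j) → Guarded (z 0) (z 1) →
                ∀ j → j ≤ k → Guarded (z j) (z (suc j))
guarded-along wrong g zero _ = g
guarded-along wrong g (suc j) j<k =
  guarded-step (guarded-along wrong g j (<⇒≤ j<k)) (wrong j j<k)

guarded-wrong⇒≢2 : ∀ {a b c} → Guarded a b → b ≢ pathGuess a c → a ≢ 2F
guarded-wrong⇒≢2 g b≢ refl = b≢ (g refl)

guarded-wrong⇒≢1 : ∀ {a b} → Guarded a b → b ≢ pathGuess a 0F → b ≢ 1F
guarded-wrong⇒≢1 {0F} _ b≢ = b≢
guarded-wrong⇒≢1 {1F} _ b≢ = b≢
guarded-wrong⇒≢1 {2F} g _ refl with g refl
... | ()

wrong-1⇒next-1 : ∀ {a c} → a ≢ 2F → c ≢ 2F → 1F ≢ pathGuess a c → c ≡ 1F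
wrong-1⇒next-1 {c = 1F} _ _ _ = refl
wrong-1⇒next-1 {c = 2F} _ c≢2 _ = ⊥-elim (c≢2 refl)
wrong-1⇒next-1 {0F} {0F} _ _ 1≢ = ⊥-elim (1≢ refl)
wrong-1⇒next-1 {1F} {0F} _ _ 1≢ = ⊥-elim (1≢ refl)
wrong-1⇒next-1 {2F} a≢2 _ _ = ⊥-elim (a≢2 refl)

readBit-true : ∀ {a b} → a ≢ 0F → (a ≡ 1F → b ≢ 1F) → readBit a b ≡ true
readBit-true {0F} a≢0 _ = ⊥-elim (a≢0 refl)
readBit-true {1F} {0F} _ _ = refl
readBit-true {1F} {1F} _ b≢1 = ⊥-elim (b≢1 refl refl)
readBit-true {1F} {2F} _ _ = refl
readBit-true {2F} _ _ = refl

readBit-false : ∀ {a b} → a ≢ 2F → (a ≡ 1F → b ≡ 1F) → readBit a b ≡ false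
readBit-false {0F} _ _ = refl
readBit-false {1F} _ b≡1 rewrite b≡1 refl = refl
readBit-false {2F} a≢2 _ = ⊥-elim (a≢2 refl)

-- Wrong guesses preserve Guarded. For the bit false it holds from the start and
-- excludes the colour 2 altogether, after which every 1 is followed by a 1. For the
-- bit true sage 1 cannot hold 0, and if it holds 1 then Guarded holds from there on
-- and the last sage cannot hold 1.
readBit-path : ∀ t {k} (z : ℕ → H) → 2 ≤ k → z 0 ≡ leftBoundary t → z (suc k) ≡ rightBoundary t →
               (∀ j → j < k → WrongAt z j) → readBit (z 1) (z k) ≡ t
readBit-path true {suc (suc k)} z (s≤s (s≤s z≤n)) z₀ z-end wrong = readBit-true z₁≢0 z₁≡1⇒z-last≢1
  where
  z₁≢0 : z 1 ≢ 0F
  z₁≢0 e = wrong 0 (s≤s z≤n) (trans e (cong (λ a → pathGuess a (z 2)) (sym z₀)))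
  z₁≡1⇒z-last≢1 : z 1 ≡ 1F → z (2 + k) ≢ 1F
  z₁≡1⇒z-last≢1 z₁≡1 = guarded-wrong⇒≢1 guarded-last wrong-last
    where
    guarded-last : Guarded (z (suc k)) (z (2 + k))
    guarded-last = guarded-along (λ j j<k → wrong (suc j) (s≤s j<k))
                                 (λ z₁≡2 → case (trans (sym z₁≡1) z₁≡2) of λ ()) k (n≤1+n k)
    wrong-last : z (2 + k) ≢ pathGuess (z (suc k)) 0F
    wrong-last = subst (λ c → z (2 + k) ≢ pathGuess (z (suc k)) c) z-end (wrong (suc k) (s≤s (s≤s ≤-refl)))
readBit-path false {suc (suc k)} z (s≤s (s≤s z≤n)) z₀ z-end wrong = readBit-false (no2 1 (s≤s z≤n)) (λ e → ones e (suc k) ≤-refl)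
  where
  guarded : ∀ j → j ≤ suc (suc k) → Guarded (z j) (z (suc j))
  guarded = guarded-along wrong (λ z₀≡2 → case trans (sym z₀) z₀≡2 of λ ())
  no2 : ∀ j → j ≤ suc (suc k) → z j ≢ 2F
  no2 j j≤ with m≤n⇒m<n∨m≡n j≤
  ... | inj₁ j< = guarded-wrong⇒≢2 (guarded j j≤) (wrong j j<)
  ... | inj₂ refl = λ e → case trans (sym z-end) (guarded j j≤ e) of λ ()
  ones : z 1 ≡ 1F → ∀ j → j < suc (suc k) → z (suc j) ≡ 1F
  ones z₁≡1 zero _ = z₁≡1
  ones z₁≡1 (suc j) j< = wrong-1⇒next-1 (no2 j (<⇒≤ (<⇒≤ j<))) (no2 (2 + j) j<)
    (λ e → wrong j (<⇒≤ j<) (trans (ones z₁≡1 j (<⇒≤ j<)) e))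

atLeast1 atLeast2 : H → Bool
atLeast1 0F = false
atLeast1 _ = true
atLeast2 2F = true
atLeast2 _ = false

fromThresholds : Bool → Bool → H
fromThresholds false _ = 0F
fromThresholds true false = 1F
fromThresholds true true = 2F

fromThresholds-thresholds : ∀ x → fromThresholds (atLeast1 x) (atLeast2 x) ≡ x
fromThresholds-thresholds 0F = refl
fromThresholds-thresholds 1F = refl
fromThresholds-thresholds 2F = refl

+-%-cancelˡ : ∀ a {x y} n → x < suc n → y < suc n → (a + x) % suc n ≡ (a + y) % suc n → x ≡ y
+-%-cancelˡ a {x} {y} n x< y< eq = begin
  x                                                 ≡⟨ sym (m<n⇒m%n≡m x<) ⟩
  x % suc n                                         ≡⟨ shift x ⟩
  (a + x + a * n) % suc n                           ≡⟨ %-distribˡ-+ (a + x) (a * n) (suc n) ⟩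
  ((a + x) % suc n + (a * n) % suc n) % suc n       ≡⟨ cong (λ r → (r + (a * n) % suc n) % suc n) eq ⟩
  ((a + y) % suc n + (a * n) % suc n) % suc n       ≡⟨ sym (%-distribˡ-+ (a + y) (a * n) (suc n)) ⟩
  (a + y + a * n) % suc n                           ≡⟨ sym (shift y) ⟩
  y % suc n                                         ≡⟨ m<n⇒m%n≡m y< ⟩
  y                                                 ∎
  where
  open ≡-Reasoning
  shift : ∀ z → z % suc n ≡ (a + z + a * n) % suc n
  shift z = begin
    z % suc n                   ≡⟨ sym ([m+kn]%n≡m%n z a (suc n)) ⟩
    (z + a * suc n) % suc n     ≡⟨ cong (λ m → (z + m) % suc n) (*-suc a n) ⟩
    (z + (a + a * n)) % suc n   ≡⟨ cong (_% suc n) (sym (+-assoc z a (a * n))) ⟩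
    (z + a + a * n) % suc n     ≡⟨ cong (λ m → (m + a * n) % suc n) (+-comm z a) ⟩
    (a + z + a * n) % suc n     ∎

adj-sym : ∀ {n} (G : Graph n) {u v} → Adj G u v → Adj G v u
adj-sym G {u} {v} = subst T (symmetric G u v)

module _ {n} {G : Graph n} (X : Cycle G) where

  cycleLength : ℕ
  cycleLength = suc (suc (suc (len₋₃ X)))

  vertexAt : ℕ → Fin n
  vertexAt j = vertex X (j mod cycleLength)

  vertexAt-cong : ∀ i j → i % cycleLength ≡ j % cycleLength → vertexAt i ≡ vertexAt j
  vertexAt-cong _ _ e = cong (vertex X) (fromℕ<-cong _ _ e _ _)

  vertexAt-injective : ∀ i j → vertexAt i ≡ vertexAt j → i % cycleLength ≡ j % cycleLength
  vertexAt-injective _ _ e = trans (sym (toℕ-fromℕ< _)) (trans (cong toℕ (distinct X e)) (toℕ-fromℕ< _))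

  vertexAt-toℕ : ∀ f → vertexAt (toℕ f) ≡ vertex X f
  vertexAt-toℕ f = cong (vertex X) (toℕ-injective (trans (toℕ-fromℕ< _) (m<n⇒m%n≡m (toℕ<n f))))

  vertex-adj-next : ∀ f → Adj G (vertex X f) (vertexAt (suc (toℕ f)))
  vertex-adj-next f with topView f
  ... | ‵fromℕ = subst (Adj G _) (sym wraps) (close X)
    where
    wraps : vertexAt (suc (toℕ (fromℕ (suc (suc (len₋₃ X)))))) ≡ vertex X zero
    wraps = trans (cong (vertexAt ∘ suc) (toℕ-fromℕ (suc (suc (len₋₃ X)))))
                  (cong (vertex X) (toℕ-injective (trans (toℕ-fromℕ< _) (n%n≡0 cycleLength))))
  ... | ‵inject₁ i = subst (Adj G _) (sym (trans (cong (vertexAt ∘ suc) (toℕ-inject₁ i)) (vertexAt-toℕ (suc i))))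
                           (step X i)

  vertexAt-adj : ∀ j → Adj G (vertexAt j) (vertexAt (suc j))
  vertexAt-adj j = subst (Adj G (vertexAt j)) (vertexAt-cong (suc (toℕ (j mod cycleLength))) (suc j) next≡) (vertex-adj-next (j mod cycleLength))
    where
    next≡ : suc (toℕ (j mod cycleLength)) % cycleLength ≡ suc j % cycleLength
    next≡ = trans (cong (λ r → suc r % cycleLength) (toℕ-fromℕ< (m%n<n j cycleLength))) (sym (%-distribˡ-+ 1 j cycleLength))

-- A cycle through w traversed from w: walk 1, …, walk inner are its other vertices.
record RootedCycle {n} (G : Graph n) (w : Fin n) : Set where
  field
    inner          : ℕ
    2≤inner        : 2 ≤ inner
    walk           : ℕ → Fin n
    walk-start     : walk 0 ≡ w
    walk-end       : walk (suc inner) ≡ w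
    walk-adj       : ∀ j → Adj G (walk j) (walk (suc j))
    walk-injective : ∀ {p q} → p ≤ inner → q ≤ inner → walk p ≡ walk q → p ≡ q

rootedAt : ∀ {n} {G : Graph n} {w} (X : Cycle G) (i : Fin (cycleLength X)) → vertex X i ≡ w → RootedCycle G w
rootedAt {G = G} X i root = record
  { inner          = suc (suc (len₋₃ X))
  ; 2≤inner        = s≤s (s≤s z≤n)
  ; walk           = λ j → vertexAt X (toℕ i + j)
  ; walk-start     = trans (cong (vertexAt X) (+-identityʳ (toℕ i))) at-root
  ; walk-end       = trans (vertexAt-cong X (toℕ i + cycleLength X) (toℕ i) ([m+n]%n≡m%n (toℕ i) (cycleLength X))) at-root
  ; walk-adj       = λ j → subst (Adj G (vertexAt X (toℕ i + j)) ∘ vertexAt X) (sym (+-suc (toℕ i) j))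
                                 (vertexAt-adj X (toℕ i + j))
  ; walk-injective = λ {p} {q} p≤ q≤ e → +-%-cancelˡ (toℕ i) _ (s≤s p≤) (s≤s q≤) (vertexAt-injective X (toℕ i + p) (toℕ i + q) e)
  }
  where
  at-root : vertexAt X (toℕ i) ≡ _
  at-root = trans (vertexAt-toℕ X i) root

module CycleStrategy {n} {G : Graph n} {w : Fin n} (L : RootedCycle G w) (τ : H → Bool) where
  open RootedCycle L

  inner-≢root : ∀ {p} → 0 < p → p ≤ inner → walk p ≢ w
  inner-≢root {suc p} _ p≤ e = case walk-injective p≤ z≤n (trans e (sym walk-start)) of λ ()

  root-adj-first : Adj G w (walk 1)
  root-adj-first = subst (λ u → Adj G u (walk 1)) walk-start (walk-adj 0)

  root-adj-last : Adj G w (walk inner)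
  root-adj-last = subst (λ u → Adj G u (walk inner)) walk-end (adj-sym G (walk-adj inner))

  mask : (Bool → H) → Fin n → H → H
  mask F u x with u ≟ w
  ... | yes _ = F (τ x)
  ... | no _ = x

  mask-root : ∀ F {u} x → u ≡ w → mask F u x ≡ F (τ x)
  mask-root F {u} x e with u ≟ w
  ... | yes _ = refl
  ... | no u≢w = ⊥-elim (u≢w e)

  mask-other : ∀ F {u} x → u ≢ w → mask F u x ≡ x
  mask-other F {u} x u≢w with u ≟ w
  ... | yes e = ⊥-elim (u≢w e)
  ... | no _ = refl

  innerGuess : ∀ p {v} → walk (suc p) ≡ v → View G v → H
  innerGuess p refl see = pathGuess (mask leftBoundary (walk p) (see (walk p) (adj-sym G (walk-adj p))))
                                    (mask rightBoundary (walk (2 + p)) (see (walk (2 + p)) (walk-adj (suc p))))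

  guessUnder : Placement n → ℕ → H
  guessUnder c p = pathGuess (mask leftBoundary (walk p) (c (walk p)))
                             (mask rightBoundary (walk (2 + p)) (c (walk (2 + p))))

  innerGuess-view : ∀ c p {v} (e : walk (suc p) ≡ v) → innerGuess p e (view G c v) ≡ guessUnder c p
  innerGuess-view c p refl = refl

  readBit-ends : ∀ c → (∀ p → p < inner → c (walk (suc p)) ≢ guessUnder c p) →
                 readBit (c (walk 1)) (c (walk inner)) ≡ τ (c w)
  readBit-ends c wrong =
    subst₂ (λ a b → readBit a b ≡ τ (c w)) (z-inner (s≤s z≤n) (<⇒≤ 2≤inner)) (z-inner (<⇒≤ 2≤inner) ≤-refl)
           (readBit-path (τ (c w)) z 2≤inner refl z-end z-wrong)
    where
    z : ℕ → H
    z zero = leftBoundary (τ (c w))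
    z (suc j) = mask rightBoundary (walk (suc j)) (c (walk (suc j)))
    z-inner : ∀ {j} → 0 < j → j ≤ inner → z j ≡ c (walk j)
    z-inner {suc j} 0<j j≤ = mask-other rightBoundary _ (inner-≢root 0<j j≤)
    z-end : z (suc inner) ≡ rightBoundary (τ (c w))
    z-end = trans (mask-root rightBoundary _ walk-end) (cong (rightBoundary ∘ τ ∘ c) walk-end)
    z-left : ∀ j → j < inner → mask leftBoundary (walk j) (c (walk j)) ≡ z j
    z-left zero _ = trans (mask-root leftBoundary _ walk-start) (cong (leftBoundary ∘ τ ∘ c) walk-start)
    z-left (suc j) j< = trans (mask-other leftBoundary _ (inner-≢root (s≤s z≤n) (<⇒≤ j<)))
                              (sym (z-inner (s≤s z≤n) (<⇒≤ j<)))
    z-wrong : ∀ j → j < inner → WrongAt z j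
    z-wrong j j< = subst₂ (λ a b → a ≢ pathGuess b (z (2 + j))) (sym (z-inner (s≤s z≤n) j<)) (z-left j j<)
                          (wrong j j<)

module TwoCycleStrategy {n} {G : Graph n} {w : Fin n} (L₁ L₂ : RootedCycle G w)
  (meet : ∀ p q → RootedCycle.walk L₁ p ≡ RootedCycle.walk L₂ q → RootedCycle.walk L₁ p ≡ w) where
  open RootedCycle
  module S₁ = CycleStrategy L₁ atLeast1
  module S₂ = CycleStrategy L₂ atLeast2

  OnCycle : RootedCycle G w → Fin n → Set
  OnCycle L v = ∃ λ p → p < inner L × walk L (suc p) ≡ v

  onCycle? : ∀ L v → Dec (OnCycle L v)
  onCycle? L v = anyUpTo? (λ p → walk L (suc p) ≟ v) (inner L)

  data Position (v : Fin n) : Set where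
    root      : v ≡ w → Position v
    onFirst   : OnCycle L₁ v → Position v
    onSecond  : OnCycle L₂ v → Position v
    elsewhere : v ≢ w → ¬ OnCycle L₁ v → ¬ OnCycle L₂ v → Position v

  position : ∀ v → Position v
  position v with v ≟ w | onCycle? L₁ v | onCycle? L₂ v
  ... | yes e    | _        | _        = root e
  ... | no _     | yes on₁  | _        = onFirst on₁
  ... | no _     | no _     | yes on₂  = onSecond on₂
  ... | no v≢w   | no off₁  | no off₂  = elsewhere v≢w off₁ off₂

  rootGuess : View G w → H
  rootGuess see = fromThresholds (readBit (see _ S₁.root-adj-first) (see _ S₁.root-adj-last))
                                 (readBit (see _ S₂.root-adj-first) (see _ S₂.root-adj-last))

  guessAt : ∀ {v} → Position v → View G v → H
  guessAt (root refl)            = rootGuess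
  guessAt (onFirst (p , _ , e))  = S₁.innerGuess p e
  guessAt (onSecond (q , _ , e)) = S₂.innerGuess q e
  guessAt (elsewhere _ _ _) _    = 0F

  strategy : Strategy G
  strategy v = guessAt (position v)

  guessAt-root : ∀ c (pos : Position w) → guessAt pos (view G c w) ≡
    fromThresholds (readBit (c (walk L₁ 1)) (c (walk L₁ (inner L₁))))
                   (readBit (c (walk L₂ 1)) (c (walk L₂ (inner L₂))))
  guessAt-root c (root refl)               = refl
  guessAt-root c (onFirst (p , p< , e))    = ⊥-elim (S₁.inner-≢root (s≤s z≤n) p< e)
  guessAt-root c (onSecond (q , q< , e))   = ⊥-elim (S₂.inner-≢root (s≤s z≤n) q< e)
  guessAt-root c (elsewhere w≢w _ _)       = ⊥-elim (w≢w refl)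

  guessAt-first : ∀ c p → p < inner L₁ → (pos : Position (walk L₁ (suc p))) →
                  guessAt pos (view G c _) ≡ S₁.guessUnder c p
  guessAt-first c p p< (root e) = ⊥-elim (S₁.inner-≢root (s≤s z≤n) p< e)
  guessAt-first c p p< (onFirst (p′ , p′< , e)) with walk-injective L₁ p′< p< e
  ... | refl = S₁.innerGuess-view c p e
  guessAt-first c p p< (onSecond (q , _ , e)) = ⊥-elim (S₁.inner-≢root (s≤s z≤n) p< (meet _ _ (sym e)))
  guessAt-first c p p< (elsewhere _ off₁ _) = ⊥-elim (off₁ (p , p< , refl))

  guessAt-second : ∀ c q → q < inner L₂ → (pos : Position (walk L₂ (suc q))) →
                   guessAt pos (view G c _) ≡ S₂.guessUnder c q
  guessAt-second c q q< (root e) = ⊥-elim (S₂.inner-≢root (s≤s z≤n) q< e)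
  guessAt-second c q q< (onFirst (p , p< , e)) =
    ⊥-elim (S₂.inner-≢root (s≤s z≤n) q< (trans (sym e) (meet _ _ e)))
  guessAt-second c q q< (onSecond (q′ , q′< , e)) with walk-injective L₂ q′< q< e
  ... | refl = S₂.innerGuess-view c q e
  guessAt-second c q q< (elsewhere _ _ off₂) = ⊥-elim (off₂ (q , q< , refl))

  winning : Winning G strategy
  winning c with any? (λ v → strategy v (view G c v) ≟ c v)
  ... | yes someoneRight = someoneRight
  ... | no nobodyRight = ⊥-elim (nobodyRight (w , rootRight))
    where
    wrong₁ : ∀ p → p < inner L₁ → c (walk L₁ (suc p)) ≢ S₁.guessUnder c p
    wrong₁ p p< e = nobodyRight (_ , trans (guessAt-first c p p< (position _)) (sym e))
    wrong₂ : ∀ q → q < inner L₂ → c (walk L₂ (suc q)) ≢ S₂.guessUnder c q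
    wrong₂ q q< e = nobodyRight (_ , trans (guessAt-second c q q< (position _)) (sym e))
    rootRight : strategy w (view G c w) ≡ c w
    rootRight = begin
      strategy w (view G c w)                             ≡⟨ guessAt-root c (position w) ⟩
      fromThresholds (readBit (c (walk L₁ 1)) (c (walk L₁ (inner L₁))))
                     (readBit (c (walk L₂ 1)) (c (walk L₂ (inner L₂))))
                                                          ≡⟨ cong₂ fromThresholds (S₁.readBit-ends c wrong₁)
                                                                                  (S₂.readBit-ends c wrong₂) ⟩
      fromThresholds (atLeast1 (c w)) (atLeast2 (c w))    ≡⟨ fromThresholds-thresholds (c w) ⟩
      c w                                                 ∎
      where open ≡-Reasoning

sagesWin-rootedCycles : ∀ {n} {G : Graph n} {w} (L₁ L₂ : RootedCycle G w) →
  (∀ p q → RootedCycle.walk L₁ p ≡ RootedCycle.walk L₂ q → RootedCycle.walk L₁ p ≡ w) → SagesWin G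
sagesWin-rootedCycles L₁ L₂ meet = strategy , winning
  where open TwoCycleStrategy L₁ L₂ meet

lemma18 : (n : ℕ) (G : Graph n) (C D : Cycle G) →
    ExactlyOneCommonVertex C D → SagesWin G
lemma18 n G C D (w , (i , Ci≡w) , (j , Dj≡w) , meet) =
  sagesWin-rootedCycles (rootedAt C i Ci≡w) (rootedAt D j Dj≡w) (λ _ _ → meet _ _)
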